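{- Let $\chi_1,\chi_2$ be Dirichlet characters modulo $q_1,q_2$ with $\chi_1\chi_2(-1)=1$, let $c\ge1$ with $q_1q_2\mid c$, and let $a$ be an integer. Then $S_{\chi_1,\chi_2}(-a,c)=-\chi_2(-1)S_{\chi_1,\chi_2}(a,c)$.
   Context: Dirichlet characters are extended by $0$ to integers not coprime to their modulus. $B_1(x)=0$ if $x\in\mathbb{Z}$ and $B_1(x)=x-\lfloor x\rfloor-\tfrac12$ otherwise. For any integer $a$ and $c\ge1$ with $q_1q_2\mid c$, \[S_{\chi_1,\chi_2}(a,c)=\sum_{j\bmod c}\sum_{n\bmod q_1}\overline{\chi_2}(j)\overline{\chi_1}(n)B_1\!\Big(\frac{j}{c}\Big)B_1\!\Big(\frac{n}{q_1}+\frac{aj}{c}\Big).\] -}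

module Defs where

open import Level using (Level; _⊔_)
open import Data.Nat as ℕ using (ℕ; zero; suc; NonZero)
open import Data.Integer as ℤ using (ℤ; +_)
open import Data.Integer.GCD as ℤG using ()
open import Data.Rational as ℚ using (ℚ)
open import Data.Rational.Properties using (+-*-commutativeRing)
open import Data.List using (List; map; upTo; foldr)
open import Relation.Binary.PropositionalEquality using (_≡_; _≢_)
open import Relation.Nullary using (yes; no)
open import Algebra.Bundles using (CommutativeRing)
open import Algebra.Morphism.Structures using (module RingMorphisms)

B₁ : ℚ → ℚ
B₁ x with ℚ.denominatorℕ x ℕ.≟ 1
... | yes _ = ℚ.0ℚ
... | no  _ = (x ℚ.- (ℚ.floor x ℚ./ 1)) ℚ.- ℚ.½

pow : ∀ {c ℓ} (R : CommutativeRing c ℓ) → CommutativeRing.Carrier R → ℕ → CommutativeRing.Carrier R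
pow R x zero    = CommutativeRing.1# R
pow R x (suc k) = CommutativeRing._*_ R x (pow R x k)

-- A commutative ring standing in for ℂ: it receives ℚ via a ring
-- homomorphism ι and carries a complex-conjugation-like ring endomorphism
-- `conj` which inverts roots of unity (as complex conjugation does).
record ComplexLike (c ℓ : Level) : Set (Level.suc (c ⊔ ℓ)) where
  field
    R : CommutativeRing c ℓ
  open CommutativeRing R public
  field
    ι       : ℚ → Carrier
    ι-hom   : RingMorphisms.IsRingHomomorphism
                (CommutativeRing.rawRing +-*-commutativeRing) rawRing ι
    conj    : Carrier → Carrier
    conj-hom : RingMorphisms.IsRingHomomorphism rawRing rawRing conj
    conj-involutive : ∀ x → conj (conj x) ≈ x

  field
    conj-root-of-unity : ∀ x k → pow R x (suc k) ≈ 1# → conj x * x ≈ 1#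

  Σ : List Carrier → Carrier
  Σ = foldr _+_ 0#

module _ {c ℓ : Level} (C : ComplexLike c ℓ) where
  open ComplexLike C

  record DirichletCharacter (q : ℕ) .{{_ : NonZero q}} : Set (c ⊔ ℓ) where
    field
      χ          : ℤ → Carrier
      periodic   : ∀ n → χ (n ℤ.+ + q) ≈ χ n
      multiplicative : ∀ m n → χ (m ℤ.* n) ≈ χ m * χ n
      χ-one      : χ (+ 1) ≈ 1#
      χ-non-coprime : ∀ n → ℤG.gcd n (+ q) ≢ + 1 → χ n ≈ 0#

  open DirichletCharacter

  S : {q₁ q₂ : ℕ} .{{_ : NonZero q₁}} .{{_ : NonZero q₂}} →
      DirichletCharacter q₁ → DirichletCharacter q₂ →
      (a : ℤ) (m : ℕ) .{{_ : NonZero m}} → Carrier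
  S {q₁} χ₁ χ₂ a m =
    Σ (map (λ j →
      Σ (map (λ n →
          conj (χ χ₂ (+ j)) * conj (χ χ₁ (+ n))
          * ι (B₁ (+ j ℚ./ m))
          * ι (B₁ ((+ n ℚ./ q₁) ℚ.+ ((a ℤ.* + j) ℚ./ m))))
        (upTo q₁)))
      (upTo m))

{-# OPTIONS --safe #-}
-- Substituting n ↦ q₁ − n in the inner sum of S(a), which is legitimate because the
-- summand is q₁-periodic in n, turns the argument of the second B₁ into
-- 1 − (n/q₁ − aj/m) and χ̄₁(n) into χ₁(−1) χ̄₁(n). Since B₁(y) = −B₁(x) whenever
-- x + y ∈ ℤ, this gives S(a) = −χ₁(−1) S(−a), and χ₁(−1) χ₂(−1) = 1 gives the claim.
module Submission where

open import Defs
open import Level using (Level)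
open import Data.Nat as ℕ using (ℕ; NonZero)
open import Data.Nat.Divisibility using (_∣_)
open import Data.Integer as ℤ using (ℤ; +_)

open import Data.Nat using (zero; suc; _∸_)
import Data.Nat.Properties as ℕP
import Data.Nat.Coprimality as Coprime
import Data.Integer.Properties as ℤP
import Data.Integer.DivMod as ℤD
import Data.Integer.Solver as ℤSolver
open import Data.Rational as ℚ using (ℚ; mkℚ)
import Data.Rational.Properties as ℚP
import Data.Rational.Solver as ℚSolver
open import Data.Rational.Unnormalised as ℚᵘ using (mkℚᵘ)
import Data.Rational.Unnormalised.Properties as ℚᵘP
open import Data.List using (map; upTo)
import Data.List.Properties as List
open import Data.Empty using (⊥-elim)
open import Function using (id; _∘_)
open import Relation.Nullary using (¬_; yes; no)
open import Relation.Binary.PropositionalEquality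
  using (_≡_; refl; sym; trans; cong; cong₂; subst; subst₂; module ≡-Reasoning)
open import Algebra.Morphism.Structures using (module RingMorphisms)

/-+ : ∀ i j n .{{_ : NonZero n}} → (i ℚ./ n) ℚ.+ (j ℚ./ n) ≡ (i ℤ.+ j) ℚ./ n
/-+ i j (suc k) = ℚP.toℚᵘ-injective (begin
    ℚ.toℚᵘ (i ℚ./ suc k ℚ.+ j ℚ./ suc k)          ≈⟨ ℚP.toℚᵘ-homo-+ (i ℚ./ suc k) (j ℚ./ suc k) ⟩
    ℚ.toℚᵘ (i ℚ./ suc k) ℚᵘ.+ ℚ.toℚᵘ (j ℚ./ suc k) ≈⟨ ℚᵘP.+-cong (ℚP.toℚᵘ-fromℚᵘ (mkℚᵘ i k)) (ℚP.toℚᵘ-fromℚᵘ (mkℚᵘ j k)) ⟩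
    mkℚᵘ i k ℚᵘ.+ mkℚᵘ j k                         ≈⟨ ℚᵘ.*≡* cross-multiplied ⟩
    mkℚᵘ (i ℤ.+ j) k                               ≈⟨ ℚᵘP.≃-sym (ℚP.toℚᵘ-fromℚᵘ (mkℚᵘ (i ℤ.+ j) k)) ⟩
    ℚ.toℚᵘ ((i ℤ.+ j) ℚ./ suc k)                   ∎)
  where
  open ℚᵘP.≃-Reasoning
  open ℤSolver.+-*-Solver
  cross-multiplied : (i ℤ.* + suc k ℤ.+ j ℤ.* + suc k) ℤ.* + suc k ≡ (i ℤ.+ j) ℤ.* + (suc k ℕ.* suc k)
  cross-multiplied rewrite ℤP.pos-* (suc k) (suc k) =
    solve 3 (λ i j d → (i :* d :+ j :* d) :* d := (i :+ j) :* (d :* d)) refl i j (+ suc k)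

neg-/ : ∀ i n .{{_ : NonZero n}} → ℚ.- (i ℚ./ n) ≡ (ℤ.- i) ℚ./ n
neg-/ i (suc k) = ℚP.toℚᵘ-injective (begin
    ℚ.toℚᵘ (ℚ.- (i ℚ./ suc k))   ≈⟨ ℚP.toℚᵘ-homo‿- (i ℚ./ suc k) ⟩
    ℚᵘ.- ℚ.toℚᵘ (i ℚ./ suc k)    ≈⟨ ℚᵘP.-‿cong (ℚP.toℚᵘ-fromℚᵘ (mkℚᵘ i k)) ⟩
    mkℚᵘ (ℤ.- i) k               ≈⟨ ℚᵘP.≃-sym (ℚP.toℚᵘ-fromℚᵘ (mkℚᵘ (ℤ.- i) k)) ⟩
    ℚ.toℚᵘ ((ℤ.- i) ℚ./ suc k)   ∎)
  where open ℚᵘP.≃-Reasoning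

n/n≡1 : ∀ n .{{_ : NonZero n}} → + n ℚ./ n ≡ ℚ.1ℚ
n/n≡1 (suc k) = ℚP.toℚᵘ-injective (ℚᵘP.≃-trans (ℚP.toℚᵘ-fromℚᵘ (mkℚᵘ (+ suc k) k)) (ℚᵘ.*≡* (ℤP.*-comm (+ suc k) (+ 1))))

m/n+[n∸m]/n≡1 : ∀ m n .{{_ : NonZero n}} → m ℕ.≤ n → (+ m ℚ./ n) ℚ.+ (+ (n ∸ m) ℚ./ n) ≡ ℚ.1ℚ
m/n+[n∸m]/n≡1 m n m≤n = begin
  (+ m ℚ./ n) ℚ.+ (+ (n ∸ m) ℚ./ n) ≡⟨ /-+ (+ m) (+ (n ∸ m)) n ⟩
  + (m ℕ.+ (n ∸ m)) ℚ./ n           ≡⟨ cong (λ k → + k ℚ./ n) (ℕP.m+[n∸m]≡n m≤n) ⟩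
  + n ℚ./ n                         ≡⟨ n/n≡1 n ⟩
  ℚ.1ℚ                              ∎
  where open ≡-Reasoning

fromℤ : ℤ → ℚ
fromℤ i = i ℚ./ 1

fromℤ≡mkℚ : ∀ i → fromℤ i ≡ mkℚ i 0 (Coprime.sym (Coprime.1-coprimeTo ℤ.∣ i ∣))
fromℤ≡mkℚ i = ℚP.↥p/↧p≡p (mkℚ i 0 _)

fromℤ-+ : ∀ i j → fromℤ i ℚ.+ fromℤ j ≡ fromℤ (i ℤ.+ j)
fromℤ-+ i j = /-+ i j 1

neg-fromℤ : ∀ i → ℚ.- fromℤ i ≡ fromℤ (ℤ.- i)
neg-fromℤ i = neg-/ i 1

fromℤ-cancel-< : ∀ {i j} → fromℤ i ℚ.< fromℤ j → i ℤ.< j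
fromℤ-cancel-< {i} {j} i<j with subst₂ ℚ._<_ (fromℤ≡mkℚ i) (fromℤ≡mkℚ j) i<j
... | ℚ.*<* i*1<j*1 = subst₂ ℤ._<_ (ℤP.*-identityʳ i) (ℤP.*-identityʳ j) i*1<j*1

fromℤ-floor-≤ : ∀ x → fromℤ (ℚ.floor x) ℚ.≤ x
fromℤ-floor-≤ x@(mkℚ p d-1 _) = subst (ℚ._≤ x) (sym (fromℤ≡mkℚ f)) (ℚ.*≤* f*d≤p*1)
  where
  f = p ℤ./ + suc d-1
  f*d≤p*1 : f ℤ.* + suc d-1 ℤ.≤ p ℤ.* + 1
  f*d≤p*1 = subst (f ℤ.* + suc d-1 ℤ.≤_) (sym (ℤP.*-identityʳ p)) (ℤD.[n/d]*d≤n p (+ suc d-1))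

<-fromℤ-suc-floor : ∀ x → x ℚ.< fromℤ (ℤ.suc (ℚ.floor x))
<-fromℤ-suc-floor x@(mkℚ p d-1 _) = subst (x ℚ.<_) (sym (fromℤ≡mkℚ (ℤ.suc f))) (ℚ.*<* p*1<[1+f]*d)
  where
  f = p ℤ./ + suc d-1
  p*1<[1+f]*d : p ℤ.* + 1 ℤ.< ℤ.suc f ℤ.* + suc d-1
  p*1<[1+f]*d = subst₂ ℤ._<_ (sym (ℤP.*-identityʳ p))
    (cong (λ g → ℤ.suc g ℤ.* + suc d-1) (sym (ℤD.div-pos-is-/ℕ p (suc d-1))))
    (ℤD.n<s[n/ℕd]*d p (suc d-1))

IsInteger : ℚ → Set
IsInteger x = ℚ.denominatorℕ x ≡ 1

isInteger-fromℤ : ∀ i → IsInteger (fromℤ i)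
isInteger-fromℤ i = cong ℚ.denominatorℕ (fromℤ≡mkℚ i)

isInteger⇒≡fromℤ : ∀ {x} → IsInteger x → x ≡ fromℤ (ℚ.↥ x)
isInteger⇒≡fromℤ {mkℚ p zero _}    refl = sym (fromℤ≡mkℚ p)
isInteger⇒≡fromℤ {mkℚ p (suc _) _} ()

fromℤ-floor-< : ∀ x → ¬ IsInteger x → fromℤ (ℚ.floor x) ℚ.< x
fromℤ-floor-< x x∉ℤ = ℚP.≰⇒> λ x≤⌊x⌋ →
  x∉ℤ (subst IsInteger (ℚP.≤-antisym (fromℤ-floor-≤ x) x≤⌊x⌋) (isInteger-fromℤ (ℚ.floor x)))

y≡[x+y]-x : ∀ x y → y ≡ (x ℚ.+ y) ℚ.- x
y≡[x+y]-x = solve 2 (λ x y → y := (x :+ y) :- x) refl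
  where open ℚSolver.+-*-Solver

isInteger-complement : ∀ x y {K} → x ℚ.+ y ≡ fromℤ K → IsInteger x → IsInteger y
isInteger-complement x y {K} x+y≡K x∈ℤ = subst IsInteger (sym y≡K-x) (isInteger-fromℤ (K ℤ.- ℚ.↥ x))
  where
  y≡K-x : y ≡ fromℤ (K ℤ.- ℚ.↥ x)
  y≡K-x = begin
    y                                   ≡⟨ y≡[x+y]-x x y ⟩
    (x ℚ.+ y) ℚ.- x                     ≡⟨ cong₂ ℚ._-_ x+y≡K (isInteger⇒≡fromℤ x∈ℤ) ⟩
    fromℤ K ℚ.- fromℤ (ℚ.↥ x)           ≡⟨ cong (fromℤ K ℚ.+_) (neg-fromℤ (ℚ.↥ x)) ⟩
    fromℤ K ℚ.+ fromℤ (ℤ.- ℚ.↥ x)       ≡⟨ fromℤ-+ K (ℤ.- ℚ.↥ x) ⟩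
    fromℤ (K ℤ.- ℚ.↥ x)                 ∎
    where open ≡-Reasoning

floor-complement : ∀ x y {K} → x ℚ.+ y ≡ fromℤ K → ¬ IsInteger x → ¬ IsInteger y →
                   K ≡ ℤ.suc (ℚ.floor x ℤ.+ ℚ.floor y)
floor-complement x y {K} x+y≡K x∉ℤ y∉ℤ = ℤP.≤-antisym K≤1+s (ℤP.i<j⇒suc[i]≤j s<K)
  where
  fx = ℚ.floor x
  fy = ℚ.floor y
  s<K : fx ℤ.+ fy ℤ.< K
  s<K = fromℤ-cancel-< (subst₂ ℚ._<_ (fromℤ-+ fx fy) x+y≡K
          (ℚP.+-mono-< (fromℤ-floor-< x x∉ℤ) (fromℤ-floor-< y y∉ℤ)))
  K<2+s : K ℤ.< ℤ.suc fx ℤ.+ ℤ.suc fy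
  K<2+s = fromℤ-cancel-< (subst₂ ℚ._<_ x+y≡K (fromℤ-+ (ℤ.suc fx) (ℤ.suc fy))
            (ℚP.+-mono-< (<-fromℤ-suc-floor x) (<-fromℤ-suc-floor y)))
  pred[2+s]≡1+s : ℤ.pred (ℤ.suc fx ℤ.+ ℤ.suc fy) ≡ ℤ.suc (fx ℤ.+ fy)
  pred[2+s]≡1+s = solve 2 (λ a b → con (ℤ.- + 1) :+ ((con (+ 1) :+ a) :+ (con (+ 1) :+ b)) := con (+ 1) :+ (a :+ b)) refl fx fy
    where open ℤSolver.+-*-Solver
  K≤1+s : K ℤ.≤ ℤ.suc (fx ℤ.+ fy)
  K≤1+s = subst (K ℤ.≤_) pred[2+s]≡1+s (ℤP.i<j⇒i≤pred[j] K<2+s)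

B₁-complement : ∀ x y {K} → x ℚ.+ y ≡ fromℤ K → B₁ y ≡ ℚ.- B₁ x
B₁-complement x y {K} x+y≡K with ℚ.denominatorℕ x ℕ.≟ 1 | ℚ.denominatorℕ y ℕ.≟ 1
... | yes _   | yes _   = refl
... | yes x∈ℤ | no y∉ℤ  = ⊥-elim (y∉ℤ (isInteger-complement x y {K} x+y≡K x∈ℤ))
... | no x∉ℤ  | yes y∈ℤ = ⊥-elim (x∉ℤ (isInteger-complement y x {K} (trans (ℚP.+-comm y x) x+y≡K) y∈ℤ))
... | no x∉ℤ  | no y∉ℤ  = begin
  (y ℚ.- Y) ℚ.- ℚ.½                             ≡⟨ cong (λ z → (z ℚ.- Y) ℚ.- ℚ.½) (y≡[x+y]-x x y) ⟩
  (((x ℚ.+ y) ℚ.- x) ℚ.- Y) ℚ.- ℚ.½             ≡⟨ cong (λ z → ((z ℚ.- x) ℚ.- Y) ℚ.- ℚ.½) (trans x+y≡K K≡1+X+Y) ⟩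
  (((ℚ.1ℚ ℚ.+ (X ℚ.+ Y)) ℚ.- x) ℚ.- Y) ℚ.- ℚ.½ ≡⟨ solve 3 (λ x X Y → (((con ℚ.1ℚ :+ (X :+ Y)) :- x) :- Y) :- con ℚ.½ := :- ((x :- X) :- con ℚ.½)) refl x X Y ⟩
  ℚ.- ((x ℚ.- X) ℚ.- ℚ.½)                       ∎
  where
  open ≡-Reasoning
  open ℚSolver.+-*-Solver
  X = fromℤ (ℚ.floor x)
  Y = fromℤ (ℚ.floor y)
  K≡1+X+Y : fromℤ K ≡ ℚ.1ℚ ℚ.+ (X ℚ.+ Y)
  K≡1+X+Y = begin
    fromℤ K                                         ≡⟨ cong fromℤ (floor-complement x y {K} x+y≡K x∉ℤ y∉ℤ) ⟩
    fromℤ (+ 1 ℤ.+ (ℚ.floor x ℤ.+ ℚ.floor y))       ≡⟨ sym (fromℤ-+ (+ 1) (ℚ.floor x ℤ.+ ℚ.floor y)) ⟩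
    ℚ.1ℚ ℚ.+ fromℤ (ℚ.floor x ℤ.+ ℚ.floor y)        ≡⟨ cong (ℚ.1ℚ ℚ.+_) (sym (fromℤ-+ (ℚ.floor x) (ℚ.floor y))) ⟩
    ℚ.1ℚ ℚ.+ (X ℚ.+ Y)                              ∎

B₁-periodic : ∀ x → B₁ (ℚ.1ℚ ℚ.+ x) ≡ B₁ x
B₁-periodic x = begin
  B₁ (ℚ.1ℚ ℚ.+ x)      ≡⟨ B₁-complement (ℚ.- x) (ℚ.1ℚ ℚ.+ x) {+ 1} -x+[1+x]≡1 ⟩
  ℚ.- B₁ (ℚ.- x)       ≡⟨ B₁-complement (ℚ.- x) x {+ 0} (ℚP.+-inverseˡ x) ⟨
  B₁ x                 ∎
  where
  open ≡-Reasoning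
  -x+[1+x]≡1 : ℚ.- x ℚ.+ (ℚ.1ℚ ℚ.+ x) ≡ fromℤ (+ 1)
  -x+[1+x]≡1 = solve 1 (λ x → :- x :+ (con ℚ.1ℚ :+ x) := con ℚ.1ℚ) refl x
    where open ℚSolver.+-*-Solver

B₁-reflect-numerator : ∀ m n .{{_ : NonZero n}} v → m ℕ.≤ n →
                       B₁ ((+ (n ∸ m) ℚ./ n) ℚ.+ v) ≡ ℚ.- B₁ ((+ m ℚ./ n) ℚ.- v)
B₁-reflect-numerator m n v m≤n = B₁-complement ((+ m ℚ./ n) ℚ.- v) ((+ (n ∸ m) ℚ./ n) ℚ.+ v) {+ 1} (begin
  ((+ m ℚ./ n) ℚ.- v) ℚ.+ ((+ (n ∸ m) ℚ./ n) ℚ.+ v)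
    ≡⟨ solve 3 (λ x y v → (x :- v) :+ (y :+ v) := x :+ y) refl (+ m ℚ./ n) (+ (n ∸ m) ℚ./ n) v ⟩
  (+ m ℚ./ n) ℚ.+ (+ (n ∸ m) ℚ./ n)
    ≡⟨ m/n+[n∸m]/n≡1 m n m≤n ⟩
  ℚ.1ℚ ∎)
  where
  open ≡-Reasoning
  open ℚSolver.+-*-Solver

B₁-numerator-periodic : ∀ n .{{_ : NonZero n}} v → B₁ ((+ n ℚ./ n) ℚ.+ v) ≡ B₁ ((+ 0 ℚ./ n) ℚ.+ v)
B₁-numerator-periodic n v = begin
  B₁ ((+ n ℚ./ n) ℚ.+ v) ≡⟨ cong (λ x → B₁ (x ℚ.+ v)) (n/n≡1 n) ⟩
  B₁ (ℚ.1ℚ ℚ.+ v)        ≡⟨ B₁-periodic v ⟩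
  B₁ v                   ≡⟨ cong B₁ (ℚP.+-identityˡ v) ⟨
  B₁ (ℚ.0ℚ ℚ.+ v)        ≡⟨ cong (λ x → B₁ (x ℚ.+ v)) (ℚP.0/n≡0 n) ⟨
  B₁ ((+ 0 ℚ./ n) ℚ.+ v) ∎
  where open ≡-Reasoning

+[m∸n]≡-1*n+m : ∀ {m n} → n ℕ.≤ m → + (m ∸ n) ≡ ℤ.-1ℤ ℤ.* + n ℤ.+ + m
+[m∸n]≡-1*n+m {m} {n} n≤m = begin
  + (m ∸ n)              ≡⟨ ℤP.⊖-≥ n≤m ⟨
  m ℤ.⊖ n                ≡⟨ ℤP.m-n≡m⊖n m n ⟨
  + m ℤ.- + n            ≡⟨ ℤP.+-comm (+ m) (ℤ.- + n) ⟩
  ℤ.- + n ℤ.+ + m        ≡⟨ cong (ℤ._+ + m) (ℤP.-1*i≡-i (+ n)) ⟨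
  ℤ.-1ℤ ℤ.* + n ℤ.+ + m  ∎
  where open ≡-Reasoning

module _ {c ℓ : Level} (C : ComplexLike c ℓ) where
  open ComplexLike C renaming (refl to ≈-refl; sym to ≈-sym; trans to ≈-trans)
  open DirichletCharacter
  open import Algebra.Properties.Ring ring using (-‿distribˡ-*; -‿distribʳ-*; -‿involutive)
  open import Algebra.Properties.CommutativeSemigroup *-commutativeSemigroup using (x∙yz≈y∙xz)
  open import Relation.Binary.Reasoning.Setoid setoid
  module ι = RingMorphisms.IsRingHomomorphism ι-hom
  module conj = RingMorphisms.IsRingHomomorphism conj-hom

  ∑ : ℕ → (ℕ → Carrier) → Carrier
  ∑ k f = Σ (map f (upTo k))

  ∑-suc-head : ∀ k (f : ℕ → Carrier) → ∑ (suc k) f ≡ f 0 + ∑ k (f ∘ suc)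
  ∑-suc-head k f = cong (λ xs → f 0 + Σ xs)
    (trans (List.map-applyUpTo suc f k) (sym (List.map-applyUpTo id (f ∘ suc) k)))

  ∑-suc : ∀ k (f : ℕ → Carrier) → ∑ (suc k) f ≈ ∑ k f + f k
  ∑-suc zero    f = +-comm (f 0) 0#
  ∑-suc (suc k) f = begin
    ∑ (suc (suc k)) f                    ≡⟨ ∑-suc-head (suc k) f ⟩
    f 0 + ∑ (suc k) (f ∘ suc)            ≈⟨ +-congˡ (∑-suc k (f ∘ suc)) ⟩
    f 0 + (∑ k (f ∘ suc) + f (suc k))    ≈⟨ +-assoc (f 0) _ _ ⟨
    (f 0 + ∑ k (f ∘ suc)) + f (suc k)    ≡⟨ cong (_+ f (suc k)) (∑-suc-head k f) ⟨
    ∑ (suc k) f + f (suc k)              ∎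

  ∑-cong< : ∀ k {f g : ℕ → Carrier} → (∀ n → n ℕ.< k → f n ≈ g n) → ∑ k f ≈ ∑ k g
  ∑-cong< zero    f≈g = ≈-refl
  ∑-cong< (suc k) {f} {g} f≈g = begin
    ∑ (suc k) f  ≈⟨ ∑-suc k f ⟩
    ∑ k f + f k  ≈⟨ +-cong (∑-cong< k (λ n n<k → f≈g n (ℕP.m<n⇒m<1+n n<k))) (f≈g k (ℕP.n<1+n k)) ⟩
    ∑ k g + g k  ≈⟨ ∑-suc k g ⟨
    ∑ (suc k) g  ∎

  ∑-*ˡ : ∀ k x (f : ℕ → Carrier) → ∑ k (λ n → x * f n) ≈ x * ∑ k f
  ∑-*ˡ zero    x f = ≈-sym (zeroʳ x)
  ∑-*ˡ (suc k) x f = begin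
    ∑ (suc k) (λ n → x * f n)   ≈⟨ ∑-suc k (λ n → x * f n) ⟩
    ∑ k (λ n → x * f n) + x * f k ≈⟨ +-congʳ (∑-*ˡ k x f) ⟩
    x * ∑ k f + x * f k         ≈⟨ distribˡ x (∑ k f) (f k) ⟨
    x * (∑ k f + f k)           ≈⟨ *-congˡ (∑-suc k f) ⟨
    x * ∑ (suc k) f             ∎

  ∑-reverse : ∀ k (f : ℕ → Carrier) → ∑ k (λ n → f (k ∸ n)) ≈ ∑ k (f ∘ suc)
  ∑-reverse zero    f = ≈-refl
  ∑-reverse (suc k) f = begin
    ∑ (suc k) (λ n → f (suc k ∸ n))   ≡⟨ ∑-suc-head k (λ n → f (suc k ∸ n)) ⟩
    f (suc k) + ∑ k (λ n → f (k ∸ n)) ≈⟨ +-congˡ (∑-reverse k f) ⟩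
    f (suc k) + ∑ k (f ∘ suc)         ≈⟨ +-comm _ _ ⟩
    ∑ k (f ∘ suc) + f (suc k)         ≈⟨ ∑-suc k (f ∘ suc) ⟨
    ∑ (suc k) (f ∘ suc)               ∎

  ∑-reflect : ∀ k (f : ℕ → Carrier) → f k ≈ f 0 → ∑ k (λ n → f (k ∸ n)) ≈ ∑ k f
  ∑-reflect zero    f _ = ≈-refl
  ∑-reflect (suc k) f fk≈f0 = begin
    ∑ (suc k) (λ n → f (suc k ∸ n)) ≈⟨ ∑-reverse (suc k) f ⟩
    ∑ (suc k) (f ∘ suc)             ≈⟨ ∑-suc k (f ∘ suc) ⟩
    ∑ k (f ∘ suc) + f (suc k)       ≈⟨ +-comm _ _ ⟩
    f (suc k) + ∑ k (f ∘ suc)       ≈⟨ +-congʳ fk≈f0 ⟩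
    f 0 + ∑ k (f ∘ suc)             ≡⟨ ∑-suc-head k f ⟨
    ∑ (suc k) f                     ∎

  module _ {q : ℕ} .{{_ : NonZero q}} (ψ : DirichletCharacter C q) where

    χ[-1]²≈1 : χ ψ ℤ.-1ℤ * χ ψ ℤ.-1ℤ ≈ 1#
    χ[-1]²≈1 = ≈-trans (≈-sym (multiplicative ψ ℤ.-1ℤ ℤ.-1ℤ)) (χ-one ψ)

    conj-χ[-1] : conj (χ ψ ℤ.-1ℤ) ≈ χ ψ ℤ.-1ℤ
    conj-χ[-1] = begin
      conj ε                ≈⟨ *-identityʳ (conj ε) ⟨
      conj ε * 1#           ≈⟨ *-congˡ χ[-1]²≈1 ⟨
      conj ε * (ε * ε)      ≈⟨ *-assoc (conj ε) ε ε ⟨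
      conj ε * ε * ε        ≈⟨ *-congʳ (conj-root-of-unity ε 1 (≈-trans (*-congˡ (*-identityʳ ε)) χ[-1]²≈1)) ⟩
      1# * ε                ≈⟨ *-identityˡ ε ⟩
      ε                     ∎
      where ε = χ ψ ℤ.-1ℤ

    χ-reflect : ∀ n → n ℕ.≤ q → χ ψ (+ (q ∸ n)) ≈ χ ψ ℤ.-1ℤ * χ ψ (+ n)
    χ-reflect n n≤q = begin
      χ ψ (+ (q ∸ n))                     ≡⟨ cong (χ ψ) (+[m∸n]≡-1*n+m n≤q) ⟩
      χ ψ (ℤ.-1ℤ ℤ.* + n ℤ.+ + q)         ≈⟨ periodic ψ (ℤ.-1ℤ ℤ.* + n) ⟩
      χ ψ (ℤ.-1ℤ ℤ.* + n)                 ≈⟨ multiplicative ψ ℤ.-1ℤ (+ n) ⟩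
      χ ψ ℤ.-1ℤ * χ ψ (+ n)               ∎

    conj-χ-reflect : ∀ n → n ℕ.≤ q → conj (χ ψ (+ (q ∸ n))) ≈ χ ψ ℤ.-1ℤ * conj (χ ψ (+ n))
    conj-χ-reflect n n≤q = begin
      conj (χ ψ (+ (q ∸ n)))              ≈⟨ conj.⟦⟧-cong (χ-reflect n n≤q) ⟩
      conj (χ ψ ℤ.-1ℤ * χ ψ (+ n))        ≈⟨ conj.*-homo (χ ψ ℤ.-1ℤ) (χ ψ (+ n)) ⟩
      conj (χ ψ ℤ.-1ℤ) * conj (χ ψ (+ n)) ≈⟨ *-congʳ conj-χ[-1] ⟩
      χ ψ ℤ.-1ℤ * conj (χ ψ (+ n))        ∎

  module _ {q₁ q₂ : ℕ} .{{_ : NonZero q₁}} .{{_ : NonZero q₂}}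
           (χ₁ : DirichletCharacter C q₁) (χ₂ : DirichletCharacter C q₂)
           (m : ℕ) .{{_ : NonZero m}} where

    -- S C χ₁ χ₂ a m unfolds to ∑ m (λ j → ∑ q₁ (summand a j)).
    summand : ℤ → ℕ → ℕ → Carrier
    summand a j n = conj (χ χ₂ (+ j)) * conj (χ χ₁ (+ n))
                  * ι (B₁ (+ j ℚ./ m)) * ι (B₁ ((+ n ℚ./ q₁) ℚ.+ ((a ℤ.* + j) ℚ./ m)))

    summand-periodic : ∀ a j → summand a j q₁ ≈ summand a j 0
    summand-periodic a j = *-cong (*-congʳ (*-congˡ (conj.⟦⟧-cong (periodic χ₁ (+ 0)))))
                                  (reflexive (cong ι (B₁-numerator-periodic q₁ ((a ℤ.* + j) ℚ./ m))))

    summand-reflect : ∀ a j n → n ℕ.≤ q₁ → summand a j (q₁ ∸ n) ≈ - χ χ₁ ℤ.-1ℤ * summand (ℤ.- a) j n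
    summand-reflect a j n n≤q₁ = begin
      summand a j (q₁ ∸ n)           ≈⟨ *-cong (*-congʳ (*-congˡ (conj-χ-reflect χ₁ n n≤q₁))) B₁-reflected ⟩
      A * (ε * X) * B * - Z          ≈⟨ -‿distribʳ-* (A * (ε * X) * B) Z ⟨
      - (A * (ε * X) * B * Z)        ≈⟨ -‿cong ε-to-front ⟩
      - (ε * (A * X * B * Z))        ≈⟨ -‿distribˡ-* ε (A * X * B * Z) ⟩
      - ε * summand (ℤ.- a) j n      ∎
      where
      ε = χ χ₁ ℤ.-1ℤ
      A = conj (χ χ₂ (+ j))
      X = conj (χ χ₁ (+ n))
      B = ι (B₁ (+ j ℚ./ m))
      v = (a ℤ.* + j) ℚ./ m
      Z = ι (B₁ ((+ n ℚ./ q₁) ℚ.+ ((ℤ.- a ℤ.* + j) ℚ./ m)))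
      -aj/m≡-v : (ℤ.- a ℤ.* + j) ℚ./ m ≡ ℚ.- v
      -aj/m≡-v = trans (cong (ℚ._/ m) (sym (ℤP.neg-distribˡ-* a (+ j)))) (sym (neg-/ (a ℤ.* + j) m))
      B₁-reflected : ι (B₁ ((+ (q₁ ∸ n) ℚ./ q₁) ℚ.+ v)) ≈ - Z
      B₁-reflected = begin
        ι (B₁ ((+ (q₁ ∸ n) ℚ./ q₁) ℚ.+ v))  ≡⟨ cong ι (B₁-reflect-numerator n q₁ v n≤q₁) ⟩
        ι (ℚ.- B₁ ((+ n ℚ./ q₁) ℚ.- v))    ≈⟨ ι.-‿homo (B₁ ((+ n ℚ./ q₁) ℚ.- v)) ⟩
        - ι (B₁ ((+ n ℚ./ q₁) ℚ.- v))      ≡⟨ cong (λ w → - ι (B₁ ((+ n ℚ./ q₁) ℚ.+ w))) -aj/m≡-v ⟨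
        - Z                                ∎
      ε-to-front : A * (ε * X) * B * Z ≈ ε * (A * X * B * Z)
      ε-to-front = begin
        A * (ε * X) * B * Z     ≈⟨ *-congʳ (*-congʳ (x∙yz≈y∙xz A ε X)) ⟩
        ε * (A * X) * B * Z     ≈⟨ *-congʳ (*-assoc ε (A * X) B) ⟩
        ε * (A * X * B) * Z     ≈⟨ *-assoc ε (A * X * B) Z ⟩
        ε * (A * X * B * Z)     ∎

    S-reflect : ∀ a → S C χ₁ χ₂ a m ≈ - χ χ₁ ℤ.-1ℤ * S C χ₁ χ₂ (ℤ.- a) m
    S-reflect a = begin
      ∑ m (λ j → ∑ q₁ (summand a j))
        ≈⟨ ∑-cong< m (λ j _ → ∑-reflect q₁ (summand a j) (summand-periodic a j)) ⟨
      ∑ m (λ j → ∑ q₁ (λ n → summand a j (q₁ ∸ n)))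
        ≈⟨ ∑-cong< m (λ j _ → ∑-cong< q₁ (λ n n<q₁ → summand-reflect a j n (ℕP.<⇒≤ n<q₁))) ⟩
      ∑ m (λ j → ∑ q₁ (λ n → - ε * summand (ℤ.- a) j n))
        ≈⟨ ∑-cong< m (λ j _ → ∑-*ˡ q₁ (- ε) (summand (ℤ.- a) j)) ⟩
      ∑ m (λ j → - ε * ∑ q₁ (summand (ℤ.- a) j))
        ≈⟨ ∑-*ˡ m (- ε) (λ j → ∑ q₁ (summand (ℤ.- a) j)) ⟩
      - ε * ∑ m (λ j → ∑ q₁ (summand (ℤ.- a) j))
        ∎
      where ε = χ χ₁ ℤ.-1ℤ

    S-neg : χ χ₁ ℤ.-1ℤ * χ χ₂ ℤ.-1ℤ ≈ 1# → ∀ a → S C χ₁ χ₂ (ℤ.- a) m ≈ - (χ χ₂ ℤ.-1ℤ * S C χ₁ χ₂ a m)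
    S-neg ε₁ε₂≈1 a = begin
      s                        ≈⟨ *-identityˡ s ⟨
      1# * s                   ≈⟨ *-congʳ ε₁ε₂≈1 ⟨
      (ε₁ * ε₂) * s            ≈⟨ *-assoc ε₁ ε₂ s ⟩
      ε₁ * (ε₂ * s)            ≈⟨ x∙yz≈y∙xz ε₁ ε₂ s ⟩
      ε₂ * (ε₁ * s)            ≈⟨ -‿involutive (ε₂ * (ε₁ * s)) ⟨
      - - (ε₂ * (ε₁ * s))      ≈⟨ -‿cong (-‿distribʳ-* ε₂ (ε₁ * s)) ⟩
      - (ε₂ * - (ε₁ * s))      ≈⟨ -‿cong (*-congˡ (-‿distribˡ-* ε₁ s)) ⟩
      - (ε₂ * (- ε₁ * s))      ≈⟨ -‿cong (*-congˡ (S-reflect a)) ⟨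
      - (ε₂ * S C χ₁ χ₂ a m)   ∎
      where
      ε₁ = χ χ₁ ℤ.-1ℤ
      ε₂ = χ χ₂ ℤ.-1ℤ
      s = S C χ₁ χ₂ (ℤ.- a) m

proposition2p3 : ∀ {c ℓ : Level} (C : ComplexLike c ℓ) (q₁ q₂ : ℕ) .{{_ : NonZero q₁}} .{{_ : NonZero q₂}} (χ₁ : DirichletCharacter C q₁) (χ₂ : DirichletCharacter C q₂) → ComplexLike._≈_ C (ComplexLike._*_ C (DirichletCharacter.χ χ₁ (ℤ.- + 1)) (DirichletCharacter.χ χ₂ (ℤ.- + 1))) (ComplexLike.1# C) → (m : ℕ) .{{_ : NonZero m}} → (q₁ ℕ.* q₂) ∣ m → (a : ℤ) → ComplexLike._≈_ C (S C χ₁ χ₂ (ℤ.- a) m) (ComplexLike.-_ C (ComplexLike._*_ C (DirichletCharacter.χ χ₂ (ℤ.- + 1)) (S C χ₁ χ₂ a m)))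
proposition2p3 C _ _ χ₁ χ₂ χ₁χ₂[-1]≈1 m _ = S-neg C χ₁ χ₂ m χ₁χ₂[-1]≈1
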